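{- Let $T$ be a tree of order $n$ with $\mathrm{diss}(T)=\frac{2n}{3}$. Then for every vertex $u$ of $T$, the tree $T$ has a maximum dissociation set not containing $u$.
   Context: A dissociation set of a graph $G$ is a vertex set $D$ such that the induced subgraph $G[D]$ has maximum degree at most $1$; $\mathrm{diss}(G)$ is the maximum order of a dissociation set, and a maximum dissociation set is a dissociation set of order $\mathrm{diss}(G)$. -}

module Defs where

open import Data.Nat using (ℕ; _≤_; _*_; _≥_)
open import Data.Bool using (Bool; true; false; T)
open import Data.Fin using (Fin)
open import Data.Fin.Subset using (Subset; _∈_; _∉_; ∣_∣)
open import Data.List using (List; []; _∷_; length; head; last)
open import Data.List.Relation.Unary.Unique.Propositional using (Unique)
open import Data.Maybe using (just)
open import Data.Product using (_×_; Σ; ∃)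
open import Relation.Binary.PropositionalEquality using (_≡_)
open import Relation.Nullary using (¬_)

record Graph (n : ℕ) : Set where
  field
    adj     : Fin n → Fin n → Bool
    symm    : ∀ u v → adj u v ≡ adj v u
    irrefl  : ∀ v → adj v v ≡ false

module _ {n : ℕ} (G : Graph n) where
  open Graph G

  Adj : Fin n → Fin n → Set
  Adj u v = T (adj u v)

  data Walk : List (Fin n) → Set where
    w-nil  : Walk []
    w-one  : ∀ v → Walk (v ∷ [])
    w-cons : ∀ u v vs → Adj u v → Walk (v ∷ vs) → Walk (u ∷ v ∷ vs)

  IsPath : Fin n → Fin n → List (Fin n) → Set
  IsPath u v p = Walk p × Unique p × head p ≡ just u × last p ≡ just v

  Connected : Set
  Connected = ∀ u v → ∃ λ p → IsPath u v p

  IsCycle : List (Fin n) → Set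
  IsCycle c = 3 ≤ length c × Walk c × Unique c
            × Σ (Fin n) λ a → Σ (Fin n) λ b →
                head c ≡ just a × last c ≡ just b × Adj b a

  Acyclic : Set
  Acyclic = ∀ c → ¬ IsCycle c

  IsTree : Set
  IsTree = Connected × Acyclic

  -- G[D] has maximum degree at most 1: every vertex of D has at most one
  -- neighbour in D
  IsDissociationSet : Subset n → Set
  IsDissociationSet D =
    ∀ v w w′ → v ∈ D → w ∈ D → w′ ∈ D → Adj v w → Adj v w′ → w ≡ w′

  IsMaxDissociationSet : Subset n → Set
  IsMaxDissociationSet D =
    IsDissociationSet D × (∀ D′ → IsDissociationSet D′ → ∣ D′ ∣ ≤ ∣ D ∣)

  DissEq : ℕ → Set
  DissEq k = ∃ λ D → IsMaxDissociationSet D × ∣ D ∣ ≡ k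

{-# OPTIONS --safe #-}

-- In a forest every vertex set S has a dissociation set of order at least
-- 2|S|/3.  Indeed, if some vertex of S has two neighbours in S, pick such an
-- internal vertex v which is adjacent to at most one other internal vertex (it
-- exists by acyclicity).  Either v has at least two pendant neighbours, which
-- are all kept while v is discarded, or it has exactly one pendant neighbour y
-- and an internal neighbour x, and {v, y} is kept while x is discarded.  In both
-- cases a dissociation set K with |K| ≥ 2 is kept at the cost of the |K| + 1
-- vertices of K ∪ {x}, and no edge of S leaves K except towards x; so induction
-- applies to S ∖ (K ∪ {x}).  Applied to V(T) ∖ {u} this gives a dissociation set
-- D avoiding u with 3|D| ≥ 2(n − 1) = 3 diss(T) − 2, which forces |D| ≥ diss(T).
module Submission where

open import Defs
open import Data.Bool using (T; true)
open import Data.Empty using (⊥-elim)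
open import Data.Fin using (Fin; _≟_)
open import Data.Fin.Properties using (any?)
open import Data.Fin.Subset
  using (Subset; _∈_; _∉_; _⊆_; _∪_; _─_; _-_; ∣_∣; ⁅_⁆; ⊤; inside; outside)
  renaming (⊥ to ∅)
open import Data.Fin.Subset.Properties
  using ( _∈?_; ∉⊥; x∈⁅x⁆; x∈⁅y⁆⇒x≡y; ∣⊥∣≡0; ∣⁅x⁆∣≡1; ∣⊤∣≡n; ∣p∣≤n
        ; p⊆p∪q; q⊆p∪q; x∈p∪q⁻; p─q⊆p; p⊆q⇒∣p∣≤∣q∣; nonempty?; p∩q≢∅⇒∣p─q∣<∣p∣
        ; x∈p∩q⁺)
open import Data.List using (List; []; _∷_; _++_; [_]; length; foldr; last)
open import Data.List.Membership.Propositional using () renaming (_∈_ to _∈ₗ_)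
open import Data.List.Membership.Propositional.Properties using (∈-∃++)
open import Data.List.Relation.Unary.All using (All; []; _∷_)
open import Data.List.Relation.Unary.All.Properties using (++⁻ˡ; ¬Any⇒All¬)
open import Data.List.Relation.Unary.AllPairs using ([]; _∷_)
open import Data.List.Relation.Unary.Any using (here; there)
open import Data.List.Relation.Unary.Unique.Propositional using (Unique)
open import Data.List.Relation.Unary.Unique.Propositional.Properties
  using (Unique[x∷xs]⇒x∉xs)
open import Data.List.Properties using (++-assoc)
open import Data.Maybe using (just)
open import Data.Nat using (ℕ; zero; suc; _+_; _*_; _≤_; _<_; s≤s; z≤n)
open import Data.Nat.Induction using (<-wellFounded)
open import Data.Nat.Properties
  using ( ≤-trans; ≤-reflexive; ≤-pred; n≤1+n; n<1+n; <⇒≱; m<m+n; +-suc; +-comm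
        ; +-mono-≤; +-monoˡ-≤; +-monoʳ-≤; *-monoˡ-≤; *-monoʳ-≤; *-suc; *-distribˡ-+; *-cancelˡ-<
        ; module ≤-Reasoning)
open import Data.Product using (_×_; _,_; proj₁; proj₂; ∃; ∃₂)
open import Data.Sum using (_⊎_; inj₁; inj₂)
open import Data.Vec using ([]; _∷_; tabulate; here; there)
open import Data.Vec.Properties using (lookup∘tabulate; []=⇒lookup; lookup⇒[]=)
open import Function using (_∘_)
open import Induction.WellFounded using (Acc; acc)
open import Relation.Binary.PropositionalEquality
  using (_≡_; _≢_; refl; sym; trans; cong; cong₂; subst; subst₂)
open import Relation.Nullary using (¬_; Dec; yes; no; does)
open import Relation.Nullary.Decidable using (_×-dec_; ¬?; dec-true; toWitness; isYes; isYes≗does; decidable-stable)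
open import Relation.Nullary.Decidable.Core using (T?)
open import Relation.Unary using (Decidable)

∣p∪q∣≡∣p∣+∣q∣ : ∀ {n} (p q : Subset n) → (∀ {x} → x ∈ p → x ∉ q) → ∣ p ∪ q ∣ ≡ ∣ p ∣ + ∣ q ∣
∣p∪q∣≡∣p∣+∣q∣ []            []            _    = refl
∣p∪q∣≡∣p∣+∣q∣ (inside  ∷ p) (inside  ∷ q) disj = ⊥-elim (disj here here)
∣p∪q∣≡∣p∣+∣q∣ (inside  ∷ p) (outside ∷ q) disj =
  cong suc (∣p∪q∣≡∣p∣+∣q∣ p q λ x∈p x∈q → disj (there x∈p) (there x∈q))
∣p∪q∣≡∣p∣+∣q∣ (outside ∷ p) (inside  ∷ q) disj =
  trans (cong suc (∣p∪q∣≡∣p∣+∣q∣ p q λ x∈p x∈q → disj (there x∈p) (there x∈q)))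
        (sym (+-suc ∣ p ∣ ∣ q ∣))
∣p∪q∣≡∣p∣+∣q∣ (outside ∷ p) (outside ∷ q) disj =
  ∣p∪q∣≡∣p∣+∣q∣ p q λ x∈p x∈q → disj (there x∈p) (there x∈q)

∣p∪q∣≤∣p∣+∣q∣ : ∀ {n} (p q : Subset n) → ∣ p ∪ q ∣ ≤ ∣ p ∣ + ∣ q ∣
∣p∪q∣≤∣p∣+∣q∣ []            []            = z≤n
∣p∪q∣≤∣p∣+∣q∣ (inside  ∷ p) (inside  ∷ q) =
  s≤s (≤-trans (∣p∪q∣≤∣p∣+∣q∣ p q) (+-monoʳ-≤ ∣ p ∣ (n≤1+n ∣ q ∣)))
∣p∪q∣≤∣p∣+∣q∣ (inside  ∷ p) (outside ∷ q) = s≤s (∣p∪q∣≤∣p∣+∣q∣ p q)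
∣p∪q∣≤∣p∣+∣q∣ (outside ∷ p) (inside  ∷ q) =
  ≤-trans (s≤s (∣p∪q∣≤∣p∣+∣q∣ p q)) (≤-reflexive (sym (+-suc ∣ p ∣ ∣ q ∣)))
∣p∪q∣≤∣p∣+∣q∣ (outside ∷ p) (outside ∷ q) = ∣p∪q∣≤∣p∣+∣q∣ p q

∣p∣≤∣p─q∣+∣q∣ : ∀ {n} (p q : Subset n) → ∣ p ∣ ≤ ∣ p ─ q ∣ + ∣ q ∣
∣p∣≤∣p─q∣+∣q∣ []            []            = z≤n
∣p∣≤∣p─q∣+∣q∣ (inside  ∷ p) (inside  ∷ q) =
  ≤-trans (s≤s (∣p∣≤∣p─q∣+∣q∣ p q)) (≤-reflexive (sym (+-suc ∣ p ─ q ∣ ∣ q ∣)))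
∣p∣≤∣p─q∣+∣q∣ (inside  ∷ p) (outside ∷ q) = s≤s (∣p∣≤∣p─q∣+∣q∣ p q)
∣p∣≤∣p─q∣+∣q∣ (outside ∷ p) (inside  ∷ q) =
  ≤-trans (∣p∣≤∣p─q∣+∣q∣ p q) (+-monoʳ-≤ ∣ p ─ q ∣ (n≤1+n ∣ q ∣))
∣p∣≤∣p─q∣+∣q∣ (outside ∷ p) (outside ∷ q) = ∣p∣≤∣p─q∣+∣q∣ p q

x∈p─q⇒x∉q : ∀ {n} {x : Fin n} (p q : Subset n) → x ∈ p ─ q → x ∉ q
x∈p─q⇒x∉q (_ ∷ p) (_ ∷ q) (there x∈p─q) (there x∈q) = x∈p─q⇒x∉q p q x∈p─q x∈q

∈⁅x⁆∪⁻ : ∀ {n} {z x : Fin n} (p : Subset n) → z ∈ ⁅ x ⁆ ∪ p → z ≡ x ⊎ z ∈ p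
∈⁅x⁆∪⁻ {x = x} p z∈ with x∈p∪q⁻ ⁅ x ⁆ p z∈
... | inj₁ z∈x = inj₁ (x∈⁅y⁆⇒x≡y x z∈x)
... | inj₂ z∈p = inj₂ z∈p

x∈⁅x⁆∪p : ∀ {n} (x : Fin n) (p : Subset n) → x ∈ ⁅ x ⁆ ∪ p
x∈⁅x⁆∪p x p = p⊆p∪q p (x∈⁅x⁆ x)

2≤∣p∣ : ∀ {n} {x y : Fin n} {p : Subset n} → x ≢ y → x ∈ p → y ∈ p → 2 ≤ ∣ p ∣
2≤∣p∣ {x = x} {y} {p} x≢y x∈p y∈p = begin
  2                 ≡⟨ cong₂ _+_ (∣⁅x⁆∣≡1 x) (∣⁅x⁆∣≡1 y) ⟨
  ∣ ⁅ x ⁆ ∣ + ∣ ⁅ y ⁆ ∣ ≡⟨ ∣p∪q∣≡∣p∣+∣q∣ ⁅ x ⁆ ⁅ y ⁆ disjoint ⟨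
  ∣ ⁅ x ⁆ ∪ ⁅ y ⁆ ∣   ≤⟨ p⊆q⇒∣p∣≤∣q∣ pair⊆p ⟩
  ∣ p ∣             ∎
  where
  open ≤-Reasoning
  disjoint : ∀ {z} → z ∈ ⁅ x ⁆ → z ∉ ⁅ y ⁆
  disjoint z∈x z∈y = x≢y (trans (sym (x∈⁅y⁆⇒x≡y x z∈x)) (x∈⁅y⁆⇒x≡y y z∈y))
  pair⊆p : ⁅ x ⁆ ∪ ⁅ y ⁆ ⊆ p
  pair⊆p z∈xy with ∈⁅x⁆∪⁻ ⁅ y ⁆ z∈xy
  ... | inj₁ refl = x∈p
  ... | inj₂ z∈y  = subst (_∈ p) (sym (x∈⁅y⁆⇒x≡y y z∈y)) y∈p

module _ {n : ℕ} where

  subset : {P : Fin n → Set} → Decidable P → Subset n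
  subset P? = tabulate (does ∘ P?)

  ∈subset⁺ : {P : Fin n → Set} (P? : Decidable P) → ∀ {x} → P x → x ∈ subset P?
  ∈subset⁺ P? {x} px = lookup⇒[]= x _ (trans (lookup∘tabulate _ x) (dec-true (P? x) px))

  ∈subset⁻ : {P : Fin n → Set} (P? : Decidable P) → ∀ {x} → x ∈ subset P? → P x
  ∈subset⁻ P? {x} x∈ = toWitness {a? = P? x} (subst T (sym isYes≡true) _)
    where
    isYes≡true : isYes (P? x) ≡ true
    isYes≡true = trans (isYes≗does (P? x)) (trans (sym (lookup∘tabulate _ x)) ([]=⇒lookup x∈))

  fromList : List (Fin n) → Subset n
  fromList = foldr (λ x s → ⁅ x ⁆ ∪ s) ∅

  ∈fromList⇒∈ : ∀ {x} xs → x ∈ fromList xs → x ∈ₗ xs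
  ∈fromList⇒∈ []       x∈ = ⊥-elim (∉⊥ x∈)
  ∈fromList⇒∈ (y ∷ ys) x∈ with ∈⁅x⁆∪⁻ (fromList ys) x∈
  ... | inj₁ x≡y  = here x≡y
  ... | inj₂ x∈ys = there (∈fromList⇒∈ ys x∈ys)

  ∣fromList∣≡length : ∀ {xs} → Unique xs → ∣ fromList xs ∣ ≡ length xs
  ∣fromList∣≡length {[]}     []           = ∣⊥∣≡0 n
  ∣fromList∣≡length {x ∷ xs} uniq@(_ ∷ uniq′) =
    trans (∣p∪q∣≡∣p∣+∣q∣ ⁅ x ⁆ (fromList xs) disjoint)
          (cong₂ _+_ (∣⁅x⁆∣≡1 x) (∣fromList∣≡length uniq′))
    where
    disjoint : ∀ {y} → y ∈ ⁅ x ⁆ → y ∉ fromList xs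
    disjoint y∈x y∈xs = Unique[x∷xs]⇒x∉xs uniq
      (subst (_∈ₗ xs) (x∈⁅y⁆⇒x≡y x y∈x) (∈fromList⇒∈ xs y∈xs))

  unique⇒length≤n : ∀ {xs} → Unique xs → length xs ≤ n
  unique⇒length≤n {xs} uniq = subst (_≤ n) (∣fromList∣≡length uniq) (∣p∣≤n (fromList xs))

2*[1+k]≤3*k : ∀ {k} → 2 ≤ k → 2 * suc k ≤ 3 * k
2*[1+k]≤3*k {k} 2≤k = subst (_≤ 3 * k) (sym (*-suc 2 k)) (+-monoˡ-≤ (2 * k) 2≤k)

3*d≤2*[s+1]∧2*s≤3*m⇒d≤m : ∀ {d s m} → 3 * d ≤ 2 * (s + 1) → 2 * s ≤ 3 * m → d ≤ m
3*d≤2*[s+1]∧2*s≤3*m⇒d≤m {d} {s} {m} 3d≤2[s+1] 2s≤3m =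
  ≤-pred (*-cancelˡ-< 3 d (suc m) (begin-strict
    3 * d             ≤⟨ 3d≤2[s+1] ⟩
    2 * (s + 1)       ≡⟨ trans (*-distribˡ-+ 2 s 1) (+-comm (2 * s) 2) ⟩
    2 + 2 * s         ≤⟨ +-monoʳ-≤ 2 2s≤3m ⟩
    2 + 3 * m         <⟨ n<1+n (2 + 3 * m) ⟩
    3 + 3 * m         ≡⟨ *-suc 3 m ⟨
    3 * suc m         ∎))
  where open ≤-Reasoning

module _ {n : ℕ} (G : Graph n) where
  open Graph G
  open import Data.List.Membership.DecPropositional (_≟_ {n}) using () renaming (_∈?_ to _∈ₗ?_)

  Adj-sym : ∀ {u v} → Adj G u v → Adj G v u
  Adj-sym {u} {v} = subst T (symm u v)

  Adj-irrefl : ∀ {v} → ¬ Adj G v v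
  Adj-irrefl {v} = subst T (irrefl v)

  Adj⇒≢ : ∀ {u v} → Adj G u v → u ≢ v
  Adj⇒≢ u~v refl = Adj-irrefl u~v

  Adj? : ∀ u v → Dec (Adj G u v)
  Adj? u v = T? (adj u v)

  Deg≤1 : Subset n → Fin n → Set
  Deg≤1 S v = ∀ {w w′} → w ∈ S → w′ ∈ S → Adj G v w → Adj G v w′ → w ≡ w′

  Deg≥2 : Subset n → Fin n → Set
  Deg≥2 S v = ∃₂ λ w w′ → w ≢ w′ × w ∈ S × w′ ∈ S × Adj G v w × Adj G v w′

  deg≥2? : ∀ S v → Dec (Deg≥2 S v)
  deg≥2? S v = any? λ w → any? λ w′ →
    ¬? (w ≟ w′) ×-dec (w ∈? S) ×-dec (w′ ∈? S) ×-dec Adj? v w ×-dec Adj? v w′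

  ¬deg≥2⇒deg≤1 : ∀ {S v} → ¬ Deg≥2 S v → Deg≤1 S v
  ¬deg≥2⇒deg≤1 ¬two {w} {w′} w∈S w′∈S v~w v~w′ =
    decidable-stable (w ≟ w′) λ w≢w′ → ¬two (w , w′ , w≢w′ , w∈S , w′∈S , v~w , v~w′)

  another-neighbour : ∀ {S v} → Deg≥2 S v → ∀ u → ∃ λ w → w ≢ u × w ∈ S × Adj G v w
  another-neighbour (w , w′ , w≢w′ , w∈S , w′∈S , v~w , v~w′) u with w ≟ u
  ... | yes refl = w′ , (λ w′≡w → w≢w′ (sym w′≡w)) , w′∈S , v~w′
  ... | no w≢u   = w , w≢u , w∈S , v~w

  Walk-++⁻ˡ : ∀ xs {ys} → Walk G (xs ++ ys) → Walk G xs
  Walk-++⁻ˡ []           _                      = w-nil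
  Walk-++⁻ˡ (x ∷ [])     _                      = w-one x
  Walk-++⁻ˡ (x ∷ y ∷ xs) (w-cons _ _ _ x~y walk) = w-cons x y xs x~y (Walk-++⁻ˡ (y ∷ xs) walk)

  Unique-++⁻ˡ : ∀ (xs : List (Fin n)) {ys} → Unique (xs ++ ys) → Unique xs
  Unique-++⁻ˡ []       _              = []
  Unique-++⁻ˡ (x ∷ xs) (x∉ ∷ uniq) = ++⁻ˡ xs x∉ ∷ Unique-++⁻ˡ xs uniq

  last-++-[x] : ∀ (xs : List (Fin n)) x → last (xs ++ [ x ]) ≡ just x
  last-++-[x] []           x = refl
  last-++-[x] (_ ∷ [])     x = refl
  last-++-[x] (_ ∷ y ∷ xs) x = last-++-[x] (y ∷ xs) x

  chord⇒cycle : ∀ {v u w} ys zs →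
                Walk G (v ∷ u ∷ ys ++ w ∷ zs) → Unique (v ∷ u ∷ ys ++ w ∷ zs) → Adj G v w →
                IsCycle G (v ∷ u ∷ ys ++ [ w ])
  chord⇒cycle {v} {u} {w} ys zs walk uniq v~w =
    s≤s (s≤s (1≤length ys)) ,
    Walk-++⁻ˡ cycle (subst (Walk G) path≡ walk) ,
    Unique-++⁻ˡ cycle (subst Unique path≡ uniq) ,
    v , w , refl , last-++-[x] (v ∷ u ∷ ys) w , Adj-sym v~w
    where
    cycle : List (Fin n)
    cycle = v ∷ u ∷ ys ++ [ w ]
    path≡ : v ∷ u ∷ ys ++ w ∷ zs ≡ cycle ++ zs
    path≡ = cong (λ l → v ∷ u ∷ l) (sym (++-assoc ys [ w ] zs))
    1≤length : ∀ xs → 1 ≤ length (xs ++ [ w ])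
    1≤length []      = s≤s z≤n
    1≤length (_ ∷ _) = s≤s z≤n

  neighbour-off-path : Acyclic G → ∀ {v u w rest} →
                       Walk G (v ∷ u ∷ rest) → Unique (v ∷ u ∷ rest) → Adj G v w → w ≢ u →
                       ¬ w ∈ₗ v ∷ u ∷ rest
  neighbour-off-path _ _ _ v~w _ (here w≡v) = Adj⇒≢ v~w (sym w≡v)
  neighbour-off-path _ _ _ _ w≢u (there (here w≡u)) = w≢u w≡u
  neighbour-off-path acyclic walk uniq v~w _ (there (there w∈rest)) with ∈-∃++ w∈rest
  ... | ys , zs , refl = acyclic _ (chord⇒cycle ys zs walk uniq v~w)

  module _ (acyclic : Acyclic G) (S : Subset n) where

    -- The path v ∷ u ∷ rest (listed from its growing end) is prolonged inside S
    -- while its end has a second neighbour in S; by acyclicity that neighbour is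
    -- new, and the fuel runs out only past n vertices, which Unique forbids.
    extend-path : ∀ fuel v u rest →
                  Walk G (v ∷ u ∷ rest) → Unique (v ∷ u ∷ rest) → All (_∈ S) (v ∷ u ∷ rest) →
                  n < fuel + length (v ∷ u ∷ rest) → ∃ λ x → x ∈ S × Deg≤1 S x
    extend-path zero v u rest _ uniq _ n<length =
      ⊥-elim (<⇒≱ n<length (unique⇒length≤n uniq))
    extend-path (suc fuel) v u rest walk uniq in-S@(v∈S ∷ _) bound with deg≥2? S v
    ... | no ¬two = v , v∈S , ¬deg≥2⇒deg≤1 ¬two
    ... | yes two with another-neighbour two u
    ...   | w , w≢u , w∈S , v~w with w ∈ₗ? v ∷ u ∷ rest
    ...     | yes w∈path = ⊥-elim (neighbour-off-path acyclic walk uniq v~w w≢u w∈path)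
    ...     | no w∉path =
      extend-path fuel w v (u ∷ rest)
        (w-cons w v (u ∷ rest) (Adj-sym v~w) walk) (¬Any⇒All¬ _ w∉path ∷ uniq) (w∈S ∷ in-S)
        (subst (n <_) (sym (+-suc fuel _)) bound)

    deg≤1-vertex : ∀ {x} → x ∈ S → ∃ λ v → v ∈ S × Deg≤1 S v
    deg≤1-vertex {x} x∈S with deg≥2? S x
    ... | no ¬two = x , x∈S , ¬deg≥2⇒deg≤1 ¬two
    ... | yes (w , _ , _ , w∈S , _ , x~w , _) =
      extend-path n w x [] (w-cons w x [] (Adj-sym x~w) (w-one x))
        ((Adj⇒≢ (Adj-sym x~w) ∷ []) ∷ [] ∷ []) (w∈S ∷ x∈S ∷ []) (m<m+n n (s≤s z≤n))

  Internal : Subset n → Fin n → Set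
  Internal S v = v ∈ S × Deg≥2 S v

  internal? : ∀ S → Decidable (Internal S)
  internal? S v = (v ∈? S) ×-dec deg≥2? S v

  internal : Subset n → Subset n
  internal S = subset (internal? S)

  record Peeling (S : Subset n) : Set where
    field
      extra       : Fin n
      kept        : Subset n
      extra∈S     : extra ∈ S
      kept⊆S      : kept ⊆ S
      2≤∣kept∣    : 2 ≤ ∣ kept ∣
      kept-diss   : IsDissociationSet G kept
      kept-closed : ∀ {a w} → a ∈ kept → w ∈ S → Adj G a w → w ≡ extra ⊎ w ∈ kept

    removed : Subset n
    removed = ⁅ extra ⁆ ∪ kept

  module _ {S : Subset n} {v : Fin n}
           (v∈I : v ∈ internal S) (v-deg≤1 : Deg≤1 (internal S) v) where

    v∈S : v ∈ S
    v∈S = proj₁ (∈subset⁻ (internal? S) v∈I)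

    Pendant : Fin n → Set
    Pendant w = w ∈ S × w ∉ internal S × Adj G v w

    pendant? : Decidable Pendant
    pendant? w = (w ∈? S) ×-dec ¬? (w ∈? internal S) ×-dec Adj? v w

    pendants : Subset n
    pendants = subset pendant?

    pendants⊆S : pendants ⊆ S
    pendants⊆S = proj₁ ∘ ∈subset⁻ pendant?

    v∉pendants : v ∉ pendants
    v∉pendants v∈P = proj₁ (proj₂ (∈subset⁻ pendant? v∈P)) v∈I

    pendant-neighbour : ∀ {p w} → p ∈ pendants → w ∈ S → Adj G p w → w ≡ v
    pendant-neighbour p∈P w∈S p~w with ∈subset⁻ pendant? p∈P
    ... | p∈S , p∉I , v~p =
      ¬deg≥2⇒deg≤1 (λ two → p∉I (∈subset⁺ (internal? S) (p∈S , two))) w∈S v∈S p~w (Adj-sym v~p)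

    two-pendants : Deg≥2 pendants v → Peeling S
    two-pendants (w , w′ , w≢w′ , w∈P , w′∈P , _ , _) = record
      { extra       = v
      ; kept        = pendants
      ; extra∈S     = v∈S
      ; kept⊆S      = pendants⊆S
      ; 2≤∣kept∣    = 2≤∣p∣ w≢w′ w∈P w′∈P
      ; kept-diss   = λ a b _ a∈P b∈P _ a~b _ →
          ⊥-elim (v∉pendants (subst (_∈ pendants) (pendant-neighbour a∈P (pendants⊆S b∈P) a~b) b∈P))
      ; kept-closed = λ a∈P w∈S a~w → inj₁ (pendant-neighbour a∈P w∈S a~w)
      }

    internal-and-pendant : Deg≤1 pendants v →
                           ∃₂ λ x y → x ∈ internal S × y ∈ pendants × Adj G v x × Adj G v y
    internal-and-pendant P-deg≤1 with proj₂ (∈subset⁻ (internal? S) v∈I)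
    ... | w , w′ , w≢w′ , w∈S , w′∈S , v~w , v~w′ with w ∈? internal S | w′ ∈? internal S
    ...   | yes w∈I | yes w′∈I = ⊥-elim (w≢w′ (v-deg≤1 w∈I w′∈I v~w v~w′))
    ...   | yes w∈I | no  w′∉I = w , w′ , w∈I , ∈subset⁺ pendant? (w′∈S , w′∉I , v~w′) , v~w , v~w′
    ...   | no  w∉I | yes w′∈I = w′ , w , w′∈I , ∈subset⁺ pendant? (w∈S , w∉I , v~w) , v~w′ , v~w
    ...   | no  w∉I | no  w′∉I = ⊥-elim (w≢w′ (P-deg≤1 (∈subset⁺ pendant? (w∈S , w∉I , v~w))
                                                       (∈subset⁺ pendant? (w′∈S , w′∉I , v~w′)) v~w v~w′))

    one-pendant : Deg≤1 pendants v → ∀ {x y} →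
                  x ∈ internal S → y ∈ pendants → Adj G v x → Adj G v y → Peeling S
    one-pendant P-deg≤1 {x} {y} x∈I y∈P v~x v~y = record
      { extra       = x
      ; kept        = K
      ; extra∈S     = proj₁ (∈subset⁻ (internal? S) x∈I)
      ; kept⊆S      = K⊆S
      ; 2≤∣kept∣    = 2≤∣p∣ (Adj⇒≢ v~y) (x∈⁅x⁆∪p v pendants) (q⊆p∪q ⁅ v ⁆ pendants y∈P)
      ; kept-diss   = K-diss
      ; kept-closed = K-closed
      }
      where
      K : Subset n
      K = ⁅ v ⁆ ∪ pendants

      K⊆S : K ⊆ S
      K⊆S a∈K with ∈⁅x⁆∪⁻ pendants a∈K
      ... | inj₁ refl = v∈S
      ... | inj₂ a∈P  = pendants⊆S a∈P

      K-neighbour-of-v : ∀ {w} → w ∈ K → Adj G v w → w ∈ pendants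
      K-neighbour-of-v w∈K v~w with ∈⁅x⁆∪⁻ pendants w∈K
      ... | inj₁ refl = ⊥-elim (Adj-irrefl v~w)
      ... | inj₂ w∈P  = w∈P

      K-diss : IsDissociationSet G K
      K-diss a w w′ a∈K w∈K w′∈K a~w a~w′ with ∈⁅x⁆∪⁻ pendants a∈K
      ... | inj₁ refl = P-deg≤1 (K-neighbour-of-v w∈K a~w) (K-neighbour-of-v w′∈K a~w′) a~w a~w′
      ... | inj₂ a∈P  = trans (pendant-neighbour a∈P (K⊆S w∈K) a~w)
                              (sym (pendant-neighbour a∈P (K⊆S w′∈K) a~w′))

      K-closed : ∀ {a w} → a ∈ K → w ∈ S → Adj G a w → w ≡ x ⊎ w ∈ K
      K-closed a∈K w∈S a~w with ∈⁅x⁆∪⁻ pendants a∈K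
      K-closed a∈K w∈S a~w | inj₂ a∈P =
        inj₂ (subst (_∈ K) (sym (pendant-neighbour a∈P w∈S a~w)) (x∈⁅x⁆∪p v pendants))
      K-closed {w = w} a∈K w∈S v~w | inj₁ refl with w ∈? internal S
      ... | yes w∈I = inj₁ (v-deg≤1 w∈I x∈I v~w v~x)
      ... | no  w∉I = inj₂ (q⊆p∪q ⁅ v ⁆ pendants (∈subset⁺ pendant? (w∈S , w∉I , v~w)))

    peeling-at : Peeling S
    peeling-at with deg≥2? pendants v
    ... | yes two = two-pendants two
    ... | no ¬two with internal-and-pendant (¬deg≥2⇒deg≤1 ¬two)
    ...   | x , y , x∈I , y∈P , v~x , v~y = one-pendant (¬deg≥2⇒deg≤1 ¬two) x∈I y∈P v~x v~y

  peeling-or-diss : Acyclic G → ∀ S → Peeling S ⊎ IsDissociationSet G S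
  peeling-or-diss acyclic S with nonempty? (internal S)
  ... | yes (x , x∈I) =
    let v , v∈I , v-deg≤1 = deg≤1-vertex acyclic (internal S) x∈I in inj₁ (peeling-at v∈I v-deg≤1)
  ... | no  no-internal = inj₂ λ v w w′ v∈S → ¬deg≥2⇒deg≤1 λ two → no-internal (v , ∈subset⁺ (internal? S) (v∈S , two))

  LargeDissIn : Subset n → Set
  LargeDissIn S = ∃ λ D → D ⊆ S × IsDissociationSet G D × 2 * ∣ S ∣ ≤ 3 * ∣ D ∣

  peel : ∀ {S} (P : Peeling S) → LargeDissIn (S ─ Peeling.removed P) → LargeDissIn S
  peel {S} P (D′ , D′⊆S─R , D′-diss , 2∣S─R∣≤3∣D′∣) = kept ∪ D′ , D⊆S , D-diss , 2∣S∣≤3∣D∣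
    where
    open Peeling P

    D′⊆S : D′ ⊆ S
    D′⊆S x∈D′ = p─q⊆p S removed (D′⊆S─R x∈D′)

    D′∩removed≡∅ : ∀ {x} → x ∈ D′ → x ∉ removed
    D′∩removed≡∅ x∈D′ = x∈p─q⇒x∉q S removed (D′⊆S─R x∈D′)

    kept∩D′≡∅ : ∀ {x} → x ∈ kept → x ∉ D′
    kept∩D′≡∅ x∈K x∈D′ = D′∩removed≡∅ x∈D′ (q⊆p∪q ⁅ extra ⁆ kept x∈K)

    kept-closed-removed : ∀ {a w} → a ∈ kept → w ∈ S → Adj G a w → w ∈ removed
    kept-closed-removed a∈K w∈S a~w with kept-closed a∈K w∈S a~w
    ... | inj₁ refl = x∈⁅x⁆∪p extra kept
    ... | inj₂ w∈K  = q⊆p∪q ⁅ extra ⁆ kept w∈K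

    D⊆S : kept ∪ D′ ⊆ S
    D⊆S x∈D with x∈p∪q⁻ kept D′ x∈D
    ... | inj₁ x∈K  = kept⊆S x∈K
    ... | inj₂ x∈D′ = D′⊆S x∈D′

    kept-side : ∀ {a w} → a ∈ kept → w ∈ kept ∪ D′ → Adj G a w → w ∈ kept
    kept-side a∈K w∈D a~w with x∈p∪q⁻ kept D′ w∈D
    ... | inj₁ w∈K  = w∈K
    ... | inj₂ w∈D′ = ⊥-elim (D′∩removed≡∅ w∈D′ (kept-closed-removed a∈K (D′⊆S w∈D′) a~w))

    D′-side : ∀ {a w} → a ∈ D′ → w ∈ kept ∪ D′ → Adj G a w → w ∈ D′
    D′-side a∈D′ w∈D a~w with x∈p∪q⁻ kept D′ w∈D
    ... | inj₂ w∈D′ = w∈D′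
    ... | inj₁ w∈K  =
      ⊥-elim (D′∩removed≡∅ a∈D′ (kept-closed-removed w∈K (D′⊆S a∈D′) (Adj-sym a~w)))

    D-diss : IsDissociationSet G (kept ∪ D′)
    D-diss a w w′ a∈D w∈D w′∈D a~w a~w′ with x∈p∪q⁻ kept D′ a∈D
    ... | inj₁ a∈K  = kept-diss a w w′ a∈K (kept-side a∈K w∈D a~w) (kept-side a∈K w′∈D a~w′) a~w a~w′
    ... | inj₂ a∈D′ = D′-diss a w w′ a∈D′ (D′-side a∈D′ w∈D a~w) (D′-side a∈D′ w′∈D a~w′) a~w a~w′

    2∣removed∣≤3∣kept∣ : 2 * ∣ removed ∣ ≤ 3 * ∣ kept ∣
    2∣removed∣≤3∣kept∣ = ≤-trans
      (*-monoʳ-≤ 2 (subst (∣ removed ∣ ≤_) (cong (_+ ∣ kept ∣) (∣⁅x⁆∣≡1 extra))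
                                             (∣p∪q∣≤∣p∣+∣q∣ ⁅ extra ⁆ kept)))
      (2*[1+k]≤3*k 2≤∣kept∣)

    2∣S∣≤3∣D∣ : 2 * ∣ S ∣ ≤ 3 * ∣ kept ∪ D′ ∣
    2∣S∣≤3∣D∣ = begin
      2 * ∣ S ∣                                ≤⟨ *-monoʳ-≤ 2 (∣p∣≤∣p─q∣+∣q∣ S removed) ⟩
      2 * (∣ S ─ removed ∣ + ∣ removed ∣)        ≡⟨ *-distribˡ-+ 2 ∣ S ─ removed ∣ ∣ removed ∣ ⟩
      2 * ∣ S ─ removed ∣ + 2 * ∣ removed ∣      ≤⟨ +-mono-≤ 2∣S─R∣≤3∣D′∣ 2∣removed∣≤3∣kept∣ ⟩
      3 * ∣ D′ ∣ + 3 * ∣ kept ∣                 ≡⟨ *-distribˡ-+ 3 ∣ D′ ∣ ∣ kept ∣ ⟨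
      3 * (∣ D′ ∣ + ∣ kept ∣)                   ≡⟨ cong (3 *_) (+-comm ∣ D′ ∣ ∣ kept ∣) ⟩
      3 * (∣ kept ∣ + ∣ D′ ∣)                   ≡⟨ cong (3 *_) (∣p∪q∣≡∣p∣+∣q∣ kept D′ kept∩D′≡∅) ⟨
      3 * ∣ kept ∪ D′ ∣                         ∎
      where open ≤-Reasoning

  largeDissIn : Acyclic G → ∀ S → LargeDissIn S
  largeDissIn acyclic S = go S (<-wellFounded ∣ S ∣)
    where
    go : ∀ S → Acc _<_ ∣ S ∣ → LargeDissIn S
    go S (acc smaller) with peeling-or-diss acyclic S
    ... | inj₂ S-diss = S , (λ x∈S → x∈S) , S-diss , *-monoˡ-≤ ∣ S ∣ (n≤1+n 2)
    ... | inj₁ P      = peel P (go (S ─ removed) (smaller ∣S─R∣<∣S∣))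
      where
      open Peeling P
      ∣S─R∣<∣S∣ : ∣ S ─ removed ∣ < ∣ S ∣
      ∣S─R∣<∣S∣ = p∩q≢∅⇒∣p─q∣<∣p∣ S removed (extra , x∈p∩q⁺ (extra∈S , x∈⁅x⁆∪p extra kept))

lemma2 : (n : ℕ) (T : Graph n) → IsTree T →
         (d : ℕ) → DissEq T d → 3 * d ≡ 2 * n →
         (u : Fin n) → ∃ λ D → IsMaxDissociationSet T D × u ∉ D
lemma2 n T (_ , acyclic) d (D₀ , (_ , D₀-max) , ∣D₀∣≡d) 3d≡2n u
  with largeDissIn T acyclic (⊤ - u)
... | D , D⊆⊤-u , D-diss , 2∣⊤-u∣≤3∣D∣ = D , (D-diss , D-max) , u∉D
  where
  u∉D : u ∉ D
  u∉D u∈D = x∈p─q⇒x∉q ⊤ ⁅ u ⁆ (D⊆⊤-u u∈D) (x∈⁅x⁆ u)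

  n≤∣⊤-u∣+1 : n ≤ ∣ ⊤ - u ∣ + 1
  n≤∣⊤-u∣+1 = subst₂ _≤_ (∣⊤∣≡n n) (cong (∣ ⊤ - u ∣ +_) (∣⁅x⁆∣≡1 u)) (∣p∣≤∣p─q∣+∣q∣ ⊤ ⁅ u ⁆)

  d≤∣D∣ : d ≤ ∣ D ∣
  d≤∣D∣ = 3*d≤2*[s+1]∧2*s≤3*m⇒d≤m {s = ∣ ⊤ - u ∣}
    (subst (_≤ 2 * (∣ ⊤ - u ∣ + 1)) (sym 3d≡2n) (*-monoʳ-≤ 2 n≤∣⊤-u∣+1)) 2∣⊤-u∣≤3∣D∣

  D-max : ∀ D′ → IsDissociationSet T D′ → ∣ D′ ∣ ≤ ∣ D ∣
  D-max D′ D′-diss = ≤-trans (subst (∣ D′ ∣ ≤_) ∣D₀∣≡d (D₀-max D′ D′-diss)) d≤∣D∣
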